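{- Let $n,m\ge1$, let $I$ be a composition of $n$ and $J$ a composition of $m$. Then, in $\mathbf{Sym}_{n+m}$ (over the field of rational functions in the $y_w$), $$P_IP_J=\sum_{K} c_{IJ}^K\,P_K,\qquad c_{IJ}^K=\frac{\langle L_{n+m}(Y^K),\,K_{n+m}(Y_I+1+Y_J)\rangle}{\langle Q_K,P_K\rangle},$$ where the sum runs over the compositions $K$ of $n+m$ in the interval $[I\triangleright(m),\,I\cdot(1^m)]$ of the refinement order, i.e. those $K$ whose boolean word has the boolean word of $I$ as a prefix, and $Y_I+1+Y_J$ denotes the sequence $(y_1(I),\dots,y_{n-1}(I),1,y_1(J),\dots,y_{m-1}(J))$ of length $n+m-1$.
   Context: $\{y_w\}$ are commuting indeterminates indexed by all nonempty boolean words $w$. For each $N\ge1$, identify $\mathbf{Sym}_N$ (noncommutative symmetric functions of degree $N$) with the Grassmann algebra on $\eta_1,\dots,\eta_{N-1}$ via $R_I\leftrightarrow\eta_{d_1}\cdots\eta_{d_k}$ ($R_I$ ribbon basis, $\mathrm{Des}(I)=\{d_1<\dots<d_k\}$, where $\mathrm{Des}(i_1,\dots,i_r)=\{i_1,i_1+i_2,\dots,i_1+\dots+i_{r-1}\}$), and $QSym_N$ with the Grassmann algebra on $\xi_1,\dots,\xi_{N-1}$ via $F_I\leftrightarrow \xi_{d_1}\cdots\xi_{d_k}$, with pairing $\langle\xi_D,\eta_E\rangle=\delta_{DE}$. The product $P_IP_J$ is the usual product of $\mathbf{Sym}$, for which $R_IR_J=R_{I\cdot J}+R_{I\triangleright J}$,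 with $I\cdot J$ the concatenation and $I\triangleright J$ the concatenation in which the last part of $I$ and first part of $J$ are added. For $Z=(z_1,\dots,z_{N-1})$: $K_N(Z)=(1+z_1\eta_1)\cdots(1+z_{N-1}\eta_{N-1})$, $L_N(Z)=(z_1-\xi_1)\cdots(z_{N-1}-\xi_{N-1})$. A composition $I$ of $N$ has boolean word $u_1\cdots u_{N-1}$, $u_k=1$ iff $k\in\mathrm{Des}(I)$; $y_k(I)=y_{u_1\cdots u_k}$, $y^k(I)=y_{u_1\cdots u_{k-1}(1-u_k)}$, $Y_I=(y_1(I),\dots,y_{N-1}(I))$, $Y^I=(y^1(I),\dots,y^{N-1}(I))$, $P_I=K_N(Y_I)$, $Q_I=L_N(Y^I)$. -}

module Defs where

open import Level using (Level; _⊔_) renaming (suc to lsuc)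
open import Algebra.Bundles using (CommutativeRing)
open import Data.Bool using (Bool; true; false; not; if_then_else_)
open import Data.Nat using (ℕ; zero; suc) renaming (_+_ to _+ℕ_)
open import Data.Vec using (Vec; []; _∷_; _++_)
open import Data.Vec.Properties using (≡-dec)
open import Data.List using (List; []; _∷_; map; concatMap; foldr)
open import Data.List.NonEmpty using (List⁺; _∷_; _∷⁺_)
import Data.Bool.Properties as BoolP
open import Relation.Nullary using (¬_; does)

record Field (c ℓ : Level) : Set (lsuc (c ⊔ ℓ)) where
  field
    commutativeRing : CommutativeRing c ℓ
  open CommutativeRing commutativeRing public
  field
    1≉0      : ¬ (1# ≈ 0#)
    inv      : (x : Carrier) → ¬ (x ≈ 0#) → Carrier
    inverseʳ : (x : Carrier) (p : ¬ (x ≈ 0#)) → x * inv x p ≈ 1#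

allWords : (d : ℕ) → List (Vec Bool d)
allWords zero    = [] ∷ []
allWords (suc d) = concatMap (λ w → (true ∷ w) ∷ (false ∷ w) ∷ []) (allWords d)

module _ {c ℓ : Level} (F : Field c ℓ) where
  open Field F

  ΣW : (d : ℕ) → (Vec Bool d → Carrier) → Carrier
  ΣW d f = foldr _+_ 0# (map f (allWords d))

  -- Sym_{d+1} (resp. QSym_{d+1}) ≅ Grassmann algebra on η_1..η_d (resp. ξ_1..ξ_d):
  -- an element is given by its coefficients on the basis
  -- R_D ↔ η_D (resp. F_D ↔ ξ_D), D ⊆ {1..d} encoded as a boolean word of
  -- length d (the boolean word of the composition, i.e. its descent set).
  Sym : ℕ → Set c
  Sym d = Vec Bool d → Carrier

  QSym : ℕ → Set c
  QSym d = Vec Bool d → Carrier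

  _≋_ : {d : ℕ} → Sym d → Sym d → Set ℓ
  f ≋ g = ∀ D → f D ≈ g D

  R : {d : ℕ} → Vec Bool d → Sym d
  R D E = if does (≡-dec BoolP._≟_ D E) then 1# else 0#

  _⊕_ : {d : ℕ} → Sym d → Sym d → Sym d
  (f ⊕ g) D = f D + g D

  _·_ : {d : ℕ} → Carrier → Sym d → Sym d
  (x · f) D = x * f D

  ΣS : {d : ℕ} (e : ℕ) → (Vec Bool e → Sym d) → Sym d
  ΣS e f D = ΣW e (λ w → f w D)

  -- product Sym_{a+1} × Sym_{b+1} → Sym_{a+b+2}: bilinear extension of
  -- R_I R_J = R_{I·J} + R_{I▷J}; in boolean words, I·J ↔ u 1 v, I▷J ↔ u 0 v.
  _⋆_ : {a b : ℕ} → Sym a → Sym b → Sym (a +ℕ suc b)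
  _⋆_ {a} {b} f g =
    ΣS a (λ D → ΣS b (λ E →
      (f D * g E) · (R (D ++ true ∷ E) ⊕ R (D ++ false ∷ E))))

  -- the pairing ⟨ξ_D, η_E⟩ = δ_{DE}, extended bilinearly
  ⟨_,_⟩ : {d : ℕ} → QSym d → Sym d → Carrier
  ⟨_,_⟩ {d} f g = ΣW d (λ D → f D * g D)

  -- K_N(Z) = (1 + z_1 η_1) ⋯ (1 + z_d η_d), expanded in the basis η_D
  -- (ordered products of distinct generators, so no signs occur):
  -- coefficient of η_D is ∏_{i ∈ D} z_i.
  KN : {d : ℕ} → Vec Carrier d → Sym d
  KN []      []          = 1#
  KN (z ∷ Z) (true  ∷ D) = z * KN Z D
  KN (z ∷ Z) (false ∷ D) = KN Z D

  -- L_N(Z) = (z_1 − ξ_1) ⋯ (z_d − ξ_d), expanded in the basis ξ_D: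
  -- coefficient of ξ_D is ∏_{i ∉ D} z_i · ∏_{i ∈ D} (−1).
  LN : {d : ℕ} → Vec Carrier d → QSym d
  LN []      []          = 1#
  LN (z ∷ Z) (true  ∷ D) = (- 1#) * LN Z D
  LN (z ∷ Z) (false ∷ D) = z * LN Z D

  -- Y_I = (y_{u_1}, y_{u_1 u_2}, …, y_{u_1⋯u_d}) for the boolean word u of I
  Ylow : (List⁺ Bool → Carrier) → {d : ℕ} → Vec Bool d → Vec Carrier d
  Ylow y []      = []
  Ylow y (b ∷ u) = y (b ∷ []) ∷ Ylow (λ w → y (b ∷⁺ w)) u

  -- Y^I = (y^1(I), …, y^d(I)),  y^k(I) = y_{u_1⋯u_{k−1}(1−u_k)}
  Yup : (List⁺ Bool → Carrier) → {d : ℕ} → Vec Bool d → Vec Carrier d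
  Yup y []      = []
  Yup y (b ∷ u) = y (not b ∷ []) ∷ Yup (λ w → y (b ∷⁺ w)) u

  P : (List⁺ Bool → Carrier) → {d : ℕ} → Vec Bool d → Sym d
  P y u = KN (Ylow y u)

  Q : (List⁺ Bool → Carrier) → {d : ℕ} → Vec Bool d → QSym d
  Q y u = LN (Yup y u)

-- Since R_I R_J = R_{I·J} + R_{I▷J}, a product K_n(Z) K_m(W) is K_{n+m}(Z, 1, W); so
-- P_I P_J = K_{n+m}(Y_I, 1, Y_J). As ⟨L_N(Z), K_N(W)⟩ = ∏ (z_i − w_i), the factor coming
-- from the common prefix Y_I cancels in c_{IJ}^K, and what remains are Lagrange weights:
-- the expansion is tensor-product Lagrange interpolation of the multi-affine map
-- Z ↦ K(Z) on the tree of nodes y_{u t}, one coordinate at a time by two-point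
-- interpolation of an affine function.
module Submission where

open import Defs
open import Data.Bool using (Bool; true; false; not)
open import Data.Nat using (ℕ; suc) renaming (_+_ to _+ℕ_)
open import Data.Vec using (Vec; []; _∷_; _++_; replicate; splitAt; toList)
open import Data.List.NonEmpty using (List⁺; _∷_; _∷⁺_; _++⁺_)
open import Relation.Nullary using (¬_)

open import Level using (Level; _⊔_)
open import Algebra.Bundles using (CommutativeRing)
open import Data.List as List using (List; foldr; map; concatMap)
open import Data.Maybe using (nothing)
open import Data.Product using (∃₂; _,_)
open import Function using (_∘_)
import Relation.Binary.PropositionalEquality as ≡

module TwoPointInterpolation {c ℓ : Level} (R : CommutativeRing c ℓ) where
  open CommutativeRing R
  open import Relation.Binary.Reasoning.Setoid setoid
  open import Algebra.Solver.Ring.NaturalCoefficients commutativeSemiring (λ _ _ → nothing)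
    using (solve; _:=_; _:+_; _:*_)
  open import Algebra.Properties.Ring ring using (-‿distribˡ-*; -‿distribʳ-*)
  open import Algebra.Properties.AbelianGroup +-abelianGroup using (⁻¹-anti-homo‿-)
  open import Algebra.Properties.Group +-group using (inverseʳ-unique)

  Affine : (Carrier → Carrier) → Set (c ⊔ ℓ)
  Affine φ = ∃₂ λ p q → ∀ z → φ z ≈ p + q * z

  x*[y-y]≈0 : ∀ x y → x * (y - y) ≈ 0#
  x*[y-y]≈0 x y = trans (*-congˡ (-‿inverseʳ y)) (zeroʳ x)

  -- The semiring solver treats each negation as an opaque atom, so identities
  -- involving cancellation are proved with the cancelling terms added to both sides.
  cancel-zeros : ∀ {a b z z′} → z ≈ 0# → z′ ≈ 0# → a + z ≈ b + z′ → a ≈ b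
  cancel-zeros {a} {b} {z} {z′} z≈0 z′≈0 eq = begin
    a       ≈⟨ +-identityʳ a ⟨
    a + 0#  ≈⟨ +-congˡ z≈0 ⟨
    a + z   ≈⟨ eq ⟩
    b + z′  ≈⟨ +-congˡ z′≈0 ⟩
    b + 0#  ≈⟨ +-identityʳ b ⟩
    b       ∎

  lagrange-numerator : ∀ {φ} → Affine φ → ∀ y₀ y₁ x →
    (y₀ - x) * φ y₁ + (x - y₁) * φ y₀ ≈ (y₀ - y₁) * φ x
  lagrange-numerator {φ} (p , q , φ≈) y₀ y₁ x = begin
    (y₀ - x) * φ y₁ + (x - y₁) * φ y₀
      ≈⟨ +-cong (*-congˡ (φ≈ y₁)) (*-congˡ (φ≈ y₀)) ⟩
    (y₀ - x) * (p + q * y₁) + (x - y₁) * (p + q * y₀)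
      ≈⟨ cancel-zeros (x*[y-y]≈0 (q * x) y₁) zeros
           (solve 7 (λ p q y₀ y₁ x nx ny₁ →
              (y₀ :+ nx) :* (p :+ q :* y₁) :+ (x :+ ny₁) :* (p :+ q :* y₀) :+ (q :* x) :* (y₁ :+ ny₁)
              := (y₀ :+ ny₁) :* (p :+ q :* x)
                 :+ (p :* (x :+ nx) :+ (q :* y₀) :* (y₁ :+ ny₁) :+ (q :* y₁) :* (x :+ nx)))
              refl p q y₀ y₁ x (- x) (- y₁)) ⟩
    (y₀ - y₁) * (p + q * x)
      ≈⟨ *-congˡ (φ≈ x) ⟨
    (y₀ - y₁) * φ x ∎
    where
    zeros : p * (x - x) + (q * y₀) * (y₁ - y₁) + (q * y₁) * (x - x) ≈ 0#
    zeros = trans (+-cong (+-cong (x*[y-y]≈0 p x) (x*[y-y]≈0 (q * y₀) y₁)) (x*[y-y]≈0 (q * y₁) x))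
                  (trans (+-congʳ (+-identityʳ 0#)) (+-identityʳ 0#))

  inverse-of-negation : ∀ {κ₀ κ₁ y₀ y₁} →
    κ₀ * (y₀ - y₁) ≈ 1# → κ₁ * (y₁ - y₀) ≈ 1# → κ₁ ≈ - κ₀
  inverse-of-negation {κ₀} {κ₁} {y₀} {y₁} h₀ h₁ = inverseʳ-unique κ₀ κ₁ (begin
    κ₀ + κ₁
      ≈⟨ +-cong (*-identityʳ κ₀) (*-identityʳ κ₁) ⟨
    κ₀ * 1# + κ₁ * 1#
      ≈⟨ +-cong (*-congˡ h₁) (*-congˡ h₀) ⟨
    κ₀ * (κ₁ * (y₁ - y₀)) + κ₁ * (κ₀ * (y₀ - y₁))
      ≈⟨ solve 4 (λ κ₀ κ₁ d d′ →
             κ₀ :* (κ₁ :* d) :+ κ₁ :* (κ₀ :* d′) := (κ₀ :* κ₁) :* (d :+ d′))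
           refl κ₀ κ₁ (y₁ - y₀) (y₀ - y₁) ⟩
    (κ₀ * κ₁) * ((y₁ - y₀) + (y₀ - y₁))
      ≈⟨ *-congˡ (+-congˡ (⁻¹-anti-homo‿- y₁ y₀)) ⟨
    (κ₀ * κ₁) * ((y₁ - y₀) - (y₁ - y₀))
      ≈⟨ x*[y-y]≈0 (κ₀ * κ₁) (y₁ - y₀) ⟩
    0# ∎)

  interpolate₂ : ∀ {φ} → Affine φ → ∀ {κ₀ κ₁ y₀ y₁} x →
    κ₀ * (y₀ - y₁) ≈ 1# → κ₁ * (y₁ - y₀) ≈ 1# →
    ((y₀ - x) * κ₀) * φ y₁ + ((y₁ - x) * κ₁) * φ y₀ ≈ φ x
  interpolate₂ {φ} affine {κ₀} {κ₁} {y₀} {y₁} x h₀ h₁ = begin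
    ((y₀ - x) * κ₀) * φ y₁ + ((y₁ - x) * κ₁) * φ y₀
      ≈⟨ +-congˡ (*-congʳ swap-sign) ⟩
    ((y₀ - x) * κ₀) * φ y₁ + ((x - y₁) * κ₀) * φ y₀
      ≈⟨ solve 5 (λ a b κ f₁ f₀ → (a :* κ) :* f₁ :+ (b :* κ) :* f₀ := κ :* (a :* f₁ :+ b :* f₀))
           refl (y₀ - x) (x - y₁) κ₀ (φ y₁) (φ y₀) ⟩
    κ₀ * ((y₀ - x) * φ y₁ + (x - y₁) * φ y₀)
      ≈⟨ *-congˡ (lagrange-numerator affine y₀ y₁ x) ⟩
    κ₀ * ((y₀ - y₁) * φ x)
      ≈⟨ *-assoc κ₀ (y₀ - y₁) (φ x) ⟨
    (κ₀ * (y₀ - y₁)) * φ x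
      ≈⟨ *-congʳ h₀ ⟩
    1# * φ x
      ≈⟨ *-identityˡ (φ x) ⟩
    φ x ∎
    where
    swap-sign : (y₁ - x) * κ₁ ≈ (x - y₁) * κ₀
    swap-sign = begin
      (y₁ - x) * κ₁     ≈⟨ *-congˡ (inverse-of-negation h₀ h₁) ⟩
      (y₁ - x) * - κ₀   ≈⟨ -‿distribʳ-* (y₁ - x) κ₀ ⟨
      - ((y₁ - x) * κ₀) ≈⟨ -‿distribˡ-* (y₁ - x) κ₀ ⟩
      - (y₁ - x) * κ₀   ≈⟨ *-congʳ (⁻¹-anti-homo‿- y₁ x) ⟩
      (x - y₁) * κ₀     ∎

module _ {c ℓ : Level} (F : Field c ℓ) where
  open Field F
  open import Relation.Binary.Reasoning.Setoid setoid
  open import Algebra.Solver.Ring.NaturalCoefficients commutativeSemiring (λ _ _ → nothing)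
    using (solve; _:=_; _:+_; _:*_)
  open import Algebra.Properties.Ring ring using (-1*x≈-x)
  open TwoPointInterpolation commutativeRing using (Affine; interpolate₂)

  ∑ : {A : Set} → List A → (A → Carrier) → Carrier
  ∑ ws f = foldr _+_ 0# (map f ws)

  ∑-cong : ∀ {A : Set} (ws : List A) {f g : A → Carrier} →
    (∀ w → f w ≈ g w) → ∑ ws f ≈ ∑ ws g
  ∑-cong List.[]       f≈g = refl
  ∑-cong (w List.∷ ws) f≈g = +-cong (f≈g w) (∑-cong ws f≈g)

  ∑-+ : ∀ {A : Set} (ws : List A) (f g : A → Carrier) →
    ∑ ws (λ w → f w + g w) ≈ ∑ ws f + ∑ ws g
  ∑-+ List.[]       f g = sym (+-identityʳ 0#)
  ∑-+ (w List.∷ ws) f g = begin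
    (f w + g w) + ∑ ws (λ w → f w + g w)
      ≈⟨ +-congˡ (∑-+ ws f g) ⟩
    (f w + g w) + (∑ ws f + ∑ ws g)
      ≈⟨ solve 4 (λ a b c d → (a :+ b) :+ (c :+ d) := (a :+ c) :+ (b :+ d))
           refl (f w) (g w) (∑ ws f) (∑ ws g) ⟩
    (f w + ∑ ws f) + (g w + ∑ ws g) ∎

  ∑-distribˡ : ∀ {A : Set} (ws : List A) (k : Carrier) (f : A → Carrier) →
    ∑ ws (λ w → k * f w) ≈ k * ∑ ws f
  ∑-distribˡ List.[]       k f = sym (zeroʳ k)
  ∑-distribˡ (w List.∷ ws) k f =
    trans (+-congˡ (∑-distribˡ ws k f)) (sym (distribˡ k (f w) (∑ ws f)))

  ∑-distribʳ : ∀ {A : Set} (ws : List A) (k : Carrier) (f : A → Carrier) →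
    ∑ ws (λ w → f w * k) ≈ ∑ ws f * k
  ∑-distribʳ ws k f = begin
    ∑ ws (λ w → f w * k) ≈⟨ ∑-cong ws (λ w → *-comm (f w) k) ⟩
    ∑ ws (λ w → k * f w) ≈⟨ ∑-distribˡ ws k f ⟩
    k * ∑ ws f           ≈⟨ *-comm k (∑ ws f) ⟩
    ∑ ws f * k           ∎

  ΣW-suc : ∀ d (f : Vec Bool (suc d) → Carrier) →
    ΣW F (suc d) f ≈ ΣW F d (λ w → f (true ∷ w) + f (false ∷ w))
  ΣW-suc d f = go (allWords d)
    where
    go : ∀ ws → ∑ (concatMap (λ w → (true ∷ w) List.∷ (false ∷ w) List.∷ List.[]) ws) f
              ≈ ∑ ws (λ w → f (true ∷ w) + f (false ∷ w))
    go List.[]       = refl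
    go (w List.∷ ws) = trans (+-congˡ (+-congˡ (go ws))) (sym (+-assoc (f (true ∷ w)) (f (false ∷ w)) _))

  ΣW-sift : ∀ d (f : Vec Bool d → Carrier) (D : Vec Bool d) →
    ΣW F d (λ w → f w * R F w D) ≈ f D
  ΣW-sift 0       f []          = trans (+-identityʳ _) (*-identityʳ (f []))
  ΣW-sift (suc d) f (true ∷ D)  = begin
    ΣW F (suc d) (λ w → f w * R F w (true ∷ D))                ≈⟨ ΣW-suc d _ ⟩
    ΣW F d (λ w → f (true ∷ w) * R F w D + f (false ∷ w) * 0#)
      ≈⟨ ∑-cong (allWords d) (λ w → trans (+-congˡ (zeroʳ _)) (+-identityʳ _)) ⟩
    ΣW F d (λ w → f (true ∷ w) * R F w D)                      ≈⟨ ΣW-sift d (f ∘ (true ∷_)) D ⟩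
    f (true ∷ D)                                               ∎
  ΣW-sift (suc d) f (false ∷ D) = begin
    ΣW F (suc d) (λ w → f w * R F w (false ∷ D))               ≈⟨ ΣW-suc d _ ⟩
    ΣW F d (λ w → f (true ∷ w) * 0# + f (false ∷ w) * R F w D)
      ≈⟨ ∑-cong (allWords d) (λ w → trans (+-congʳ (zeroʳ _)) (+-identityˡ _)) ⟩
    ΣW F d (λ w → f (false ∷ w) * R F w D)                     ≈⟨ ΣW-sift d (f ∘ (false ∷_)) D ⟩
    f (false ∷ D)                                              ∎

  R-++ : ∀ {d e} (D D′ : Vec Bool d) (E E′ : Vec Bool e) →
    R F (D ++ E) (D′ ++ E′) ≈ R F D D′ * R F E E′
  R-++ []          []           E E′ = sym (*-identityˡ _)
  R-++ (true ∷ D)  (true ∷ D′)  E E′ = R-++ D D′ E E′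
  R-++ (true ∷ D)  (false ∷ D′) E E′ = sym (zeroˡ _)
  R-++ (false ∷ D) (true ∷ D′)  E E′ = sym (zeroˡ _)
  R-++ (false ∷ D) (false ∷ D′) E E′ = R-++ D D′ E E′

  R-∷-sum : ∀ {e} (x : Bool) (E E′ : Vec Bool e) →
    R F (true ∷ E) (x ∷ E′) + R F (false ∷ E) (x ∷ E′) ≈ R F E E′
  R-∷-sum true  E E′ = +-identityʳ _
  R-∷-sum false E E′ = +-identityˡ _

  -- I·J and I▷J differ only in the letter at the junction, so the product
  -- coefficient at D ++ x ∷ E does not depend on x.
  ⋆-apply : ∀ {a b} (f : Sym F a) (g : Sym F b) D x E → _⋆_ F f g (D ++ x ∷ E) ≈ f D * g E
  ⋆-apply {a} {b} f g D x E = begin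
    _⋆_ F f g (D ++ x ∷ E)
      ≈⟨ ∑-cong (allWords a) (λ D′ → ∑-cong (allWords b) (λ E′ → term D′ E′)) ⟩
    ΣW F a (λ D′ → ΣW F b (λ E′ → (f D′ * R F D′ D) * (g E′ * R F E′ E)))
      ≈⟨ ∑-cong (allWords a) (λ D′ → ∑-distribˡ (allWords b) _ _) ⟩
    ΣW F a (λ D′ → (f D′ * R F D′ D) * ΣW F b (λ E′ → g E′ * R F E′ E))
      ≈⟨ ∑-cong (allWords a) (λ D′ → *-congˡ (ΣW-sift b g E)) ⟩
    ΣW F a (λ D′ → (f D′ * R F D′ D) * g E)
      ≈⟨ ∑-distribʳ (allWords a) _ _ ⟩
    ΣW F a (λ D′ → f D′ * R F D′ D) * g E
      ≈⟨ *-congʳ (ΣW-sift a f D) ⟩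
    f D * g E ∎
    where
    term : ∀ D′ E′ →
      (f D′ * g E′) * (R F (D′ ++ true ∷ E′) (D ++ x ∷ E) + R F (D′ ++ false ∷ E′) (D ++ x ∷ E))
        ≈ (f D′ * R F D′ D) * (g E′ * R F E′ E)
    term D′ E′ = begin
      (f D′ * g E′) * (R F (D′ ++ true ∷ E′) (D ++ x ∷ E) + R F (D′ ++ false ∷ E′) (D ++ x ∷ E))
        ≈⟨ *-congˡ (+-cong (R-++ D′ D (true ∷ E′) (x ∷ E)) (R-++ D′ D (false ∷ E′) (x ∷ E))) ⟩
      (f D′ * g E′) * (R F D′ D * R F (true ∷ E′) (x ∷ E) + R F D′ D * R F (false ∷ E′) (x ∷ E))
        ≈⟨ *-congˡ (trans (sym (distribˡ _ _ _)) (*-congˡ (R-∷-sum x E′ E))) ⟩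
      (f D′ * g E′) * (R F D′ D * R F E′ E)
        ≈⟨ solve 4 (λ a b c d → (a :* b) :* (c :* d) := (a :* c) :* (b :* d)) refl _ _ _ _ ⟩
      (f D′ * R F D′ D) * (g E′ * R F E′ E) ∎

  ≋-from-++ : ∀ {a e} {f g : Sym F (a +ℕ e)} →
    (∀ (D : Vec Bool a) (E : Vec Bool e) → f (D ++ E) ≈ g (D ++ E)) → _≋_ F f g
  ≋-from-++ {a} eq D′ with splitAt a D′
  ... | D , E , ≡.refl = eq D E

  KN-++ : ∀ {d e} (Z : Vec Carrier d) (W : Vec Carrier e) D E →
    KN F (Z ++ W) (D ++ E) ≈ KN F Z D * KN F W E
  KN-++ []      W []          E = sym (*-identityˡ _)
  KN-++ (z ∷ Z) W (true ∷ D)  E = trans (*-congˡ (KN-++ Z W D E)) (sym (*-assoc _ _ _))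
  KN-++ (z ∷ Z) W (false ∷ D) E = KN-++ Z W D E

  KN-1∷ : ∀ {d} (Z : Vec Carrier d) x E → KN F (1# ∷ Z) (x ∷ E) ≈ KN F Z E
  KN-1∷ Z true  E = *-identityˡ _
  KN-1∷ Z false E = refl

  KN-affine : ∀ e → Affine (λ z → KN F (z ∷ []) (e ∷ []))
  KN-affine true  = 0# , 1# , λ z → trans (*-identityʳ z) (sym (trans (+-identityˡ _) (*-identityˡ z)))
  KN-affine false = 1# , 0# , λ z → sym (trans (+-congˡ (zeroˡ z)) (+-identityʳ 1#))

  KN-⋆ : ∀ {a b} (Z : Vec Carrier a) (W : Vec Carrier b) →
    _≋_ F (_⋆_ F (KN F Z) (KN F W)) (KN F (Z ++ 1# ∷ W))
  KN-⋆ {a} {b} Z W = ≋-from-++ {a} {suc b} λ { D (x ∷ E) → begin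
    _⋆_ F (KN F Z) (KN F W) (D ++ x ∷ E) ≈⟨ ⋆-apply (KN F Z) (KN F W) D x E ⟩
    KN F Z D * KN F W E                  ≈⟨ *-congˡ (KN-1∷ W x E) ⟨
    KN F Z D * KN F (1# ∷ W) (x ∷ E)     ≈⟨ KN-++ Z (1# ∷ W) D (x ∷ E) ⟨
    KN F (Z ++ 1# ∷ W) (D ++ x ∷ E)      ∎ }

  prodDiff : ∀ {d} → Vec Carrier d → Vec Carrier d → Carrier
  prodDiff []      []      = 1#
  prodDiff (z ∷ Z) (w ∷ W) = (z - w) * prodDiff Z W

  prodDiff-++ : ∀ {d e} (Z W : Vec Carrier d) (Z′ W′ : Vec Carrier e) →
    prodDiff (Z ++ Z′) (W ++ W′) ≈ prodDiff Z W * prodDiff Z′ W′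
  prodDiff-++ []      []      Z′ W′ = sym (*-identityˡ _)
  prodDiff-++ (z ∷ Z) (w ∷ W) Z′ W′ = trans (*-congˡ (prodDiff-++ Z W Z′ W′)) (sym (*-assoc _ _ _))

  pairing-LN-KN : ∀ {d} (Z W : Vec Carrier d) → ⟨_,_⟩ F (LN F Z) (KN F W) ≈ prodDiff Z W
  pairing-LN-KN []              []      = trans (+-identityʳ _) (*-identityʳ 1#)
  pairing-LN-KN {suc d} (z ∷ Z) (w ∷ W) = begin
    ⟨_,_⟩ F (LN F (z ∷ Z)) (KN F (w ∷ W))
      ≈⟨ ΣW-suc d _ ⟩
    ΣW F d (λ D → (- 1# * LN F Z D) * (w * KN F W D) + (z * LN F Z D) * KN F W D)
      ≈⟨ ∑-cong (allWords d) (λ D → trans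
           (solve 5 (λ m l w k z → (m :* l) :* (w :* k) :+ (z :* l) :* k := (z :+ m :* w) :* (l :* k))
              refl (- 1#) (LN F Z D) w (KN F W D) z)
           (*-congʳ (+-congˡ (-1*x≈-x w)))) ⟩
    ΣW F d (λ D → (z - w) * (LN F Z D * KN F W D))
      ≈⟨ ∑-distribˡ (allWords d) _ _ ⟩
    (z - w) * ⟨_,_⟩ F (LN F Z) (KN F W)
      ≈⟨ *-congˡ (pairing-LN-KN Z W) ⟩
    (z - w) * prodDiff Z W ∎

  shift : ∀ {a} → (List⁺ Bool → Carrier) → Vec Bool a → List⁺ Bool → Carrier
  shift y u = y ∘ (toList u ++⁺_)

  Ylow-++ : ∀ {a e} (y : List⁺ Bool → Carrier) (u : Vec Bool a) (t : Vec Bool e) →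
    Ylow F y (u ++ t) ≡.≡ Ylow F y u ++ Ylow F (shift y u) t
  Ylow-++ y []      t = ≡.refl
  Ylow-++ y (b ∷ u) t = ≡.cong (y (b ∷ List.[]) ∷_) (Ylow-++ (λ w → y (b ∷⁺ w)) u t)

  Yup-++ : ∀ {a e} (y : List⁺ Bool → Carrier) (u : Vec Bool a) (t : Vec Bool e) →
    Yup F y (u ++ t) ≡.≡ Yup F y u ++ Yup F (shift y u) t
  Yup-++ y []      t = ≡.refl
  Yup-++ y (b ∷ u) t = ≡.cong (y (not b ∷ List.[]) ∷_) (Yup-++ (λ w → y (b ∷⁺ w)) u t)

  pairing-Yup-++ : ∀ {a e} (y : List⁺ Bool → Carrier) (u : Vec Bool a) (t : Vec Bool e) W →
    ⟨_,_⟩ F (LN F (Yup F y (u ++ t))) (KN F (Ylow F y u ++ W))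
      ≈ prodDiff (Yup F y u) (Ylow F y u) * prodDiff (Yup F (shift y u) t) W
  pairing-Yup-++ y u t W = begin
    ⟨_,_⟩ F (LN F (Yup F y (u ++ t))) (KN F (Ylow F y u ++ W))
      ≈⟨ pairing-LN-KN (Yup F y (u ++ t)) (Ylow F y u ++ W) ⟩
    prodDiff (Yup F y (u ++ t)) (Ylow F y u ++ W)
      ≡⟨ ≡.cong (λ Z → prodDiff Z (Ylow F y u ++ W)) (Yup-++ y u t) ⟩
    prodDiff (Yup F y u ++ Yup F (shift y u) t) (Ylow F y u ++ W)
      ≈⟨ prodDiff-++ (Yup F y u) (Ylow F y u) (Yup F (shift y u) t) W ⟩
    prodDiff (Yup F y u) (Ylow F y u) * prodDiff (Yup F (shift y u) t) W ∎

  -- Tensor-product Lagrange interpolation on the tree of nodes Ylow y t; ι t is an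
  -- arbitrary inverse of the node-difference product.
  KN-interpolation : ∀ {e} (y : List⁺ Bool → Carrier) (X : Vec Carrier e) (ι : Vec Bool e → Carrier) →
    (∀ t → prodDiff (Yup F y t) (Ylow F y t) * ι t ≈ 1#) → ∀ E →
    ΣW F e (λ t → (prodDiff (Yup F y t) X * ι t) * KN F (Ylow F y t) E) ≈ KN F X E
  KN-interpolation y []      ι ι-inverse [] =
    trans (+-identityʳ _) (trans (*-identityʳ _) (ι-inverse []))
  KN-interpolation {suc e} y (x ∷ X) ι ι-inverse (e₀ ∷ E) = begin
    ΣW F (suc e) f
      ≈⟨ ΣW-suc e f ⟩
    ΣW F e (λ t → f (true ∷ t) + f (false ∷ t))
      ≈⟨ ∑-cong (allWords e) (λ t → +-cong (split true t) (split false t)) ⟩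
    ΣW F e (λ t → coeff true * g true t + coeff false * g false t)
      ≈⟨ ∑-+ (allWords e) _ _ ⟩
    ΣW F e (λ t → coeff true * g true t) + ΣW F e (λ t → coeff false * g false t)
      ≈⟨ +-cong (∑-distribˡ (allWords e) _ _) (∑-distribˡ (allWords e) _ _) ⟩
    coeff true * ΣW F e (g true) + coeff false * ΣW F e (g false)
      ≈⟨ +-cong (*-congˡ (sub-interpolation true)) (*-congˡ (sub-interpolation false)) ⟩
    coeff true * KN F X E + coeff false * KN F X E
      ≈⟨ distribʳ _ _ _ ⟨
    (coeff true + coeff false) * KN F X E
      ≈⟨ *-congʳ (interpolate₂ (KN-affine e₀) x (κ-inverse true) (κ-inverse false)) ⟩
    φ x * KN F X E
      ≈⟨ KN-++ (x ∷ []) X (e₀ ∷ []) E ⟨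
    KN F (x ∷ X) (e₀ ∷ E) ∎
    where
    f : Vec Bool (suc e) → Carrier
    f t = (prodDiff (Yup F y t) (x ∷ X) * ι t) * KN F (Ylow F y t) (e₀ ∷ E)
    φ : Carrier → Carrier
    φ z = KN F (z ∷ []) (e₀ ∷ [])
    below : Bool → List⁺ Bool → Carrier
    below b w = y (b ∷⁺ w)
    node : Bool → Carrier
    node b = y (b ∷ List.[])
    δ : Bool → Carrier
    δ b = node (not b) - node b
    ι′ : Bool → Vec Bool e → Carrier
    ι′ b t = δ b * ι (b ∷ t)
    ι′-inverse : ∀ b t → prodDiff (Yup F (below b) t) (Ylow F (below b) t) * ι′ b t ≈ 1#
    ι′-inverse b t = trans (solve 3 (λ p d i → p :* (d :* i) := (d :* p) :* i) refl _ (δ b) _)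
                           (ι-inverse (b ∷ t))
    -- Any branch t yields an inverse of δ b; the all-false one is as good as any.
    κ : Bool → Carrier
    κ b = prodDiff (Yup F (below b) r) (Ylow F (below b) r) * ι (b ∷ r)
      where r = replicate e false
    κ-inverse : ∀ b → κ b * δ b ≈ 1#
    κ-inverse b = trans (solve 3 (λ p i d → (p :* i) :* d := (d :* p) :* i) refl _ _ (δ b))
                        (ι-inverse (b ∷ replicate e false))
    ι-factor : ∀ b t → ι (b ∷ t) ≈ κ b * ι′ b t
    ι-factor b t = begin
      ι (b ∷ t)               ≈⟨ *-identityˡ _ ⟨
      1# * ι (b ∷ t)          ≈⟨ *-congʳ (κ-inverse b) ⟨
      (κ b * δ b) * ι (b ∷ t) ≈⟨ *-assoc _ _ _ ⟩
      κ b * ι′ b t            ∎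
    coeff : Bool → Carrier
    coeff b = ((node (not b) - x) * κ b) * φ (node b)
    g : Bool → Vec Bool e → Carrier
    g b t = (prodDiff (Yup F (below b) t) X * ι′ b t) * KN F (Ylow F (below b) t) E
    split : ∀ b t → f (b ∷ t) ≈ coeff b * g b t
    split b t = trans
      (*-cong (*-congˡ (ι-factor b t)) (KN-++ (node b ∷ []) (Ylow F (below b) t) (e₀ ∷ []) E))
      (solve 6 (λ a p k i h K → ((a :* p) :* (k :* i)) :* (h :* K) := ((a :* k) :* h) :* ((p :* i) :* K))
         refl _ _ _ _ _ _)
    sub-interpolation : ∀ b → ΣW F e (g b) ≈ KN F X E
    sub-interpolation b = KN-interpolation (below b) X (ι′ b) (ι′-inverse b) E

  KN-expansion : ∀ {a e} (y : List⁺ Bool → Carrier) (u : Vec Bool a) (X : Vec Carrier e)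
    (nz : (t : Vec Bool e) → ¬ (⟨_,_⟩ F (Q F y (u ++ t)) (P F y (u ++ t)) ≈ 0#)) →
    _≋_ F (ΣS F e (λ t →
             _·_ F (⟨_,_⟩ F (LN F (Yup F y (u ++ t))) (KN F (Ylow F y u ++ X))
                     * inv (⟨_,_⟩ F (Q F y (u ++ t)) (P F y (u ++ t))) (nz t))
                   (P F y (u ++ t))))
          (KN F (Ylow F y u ++ X))
  KN-expansion {a} {e} y u X nz = ≋-from-++ {a} {e} λ D E → begin
    ΣW F e (λ t → coefficient t * KN F (Ylow F y (u ++ t)) (D ++ E))
      ≈⟨ ∑-cong (allWords e) (λ t → term t D E) ⟩
    ΣW F e (λ t → KN F (Ylow F y u) D * ((prodDiff (Yup F y′ t) X * ι t) * KN F (Ylow F y′ t) E))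
      ≈⟨ ∑-distribˡ (allWords e) _ _ ⟩
    KN F (Ylow F y u) D * ΣW F e (λ t → (prodDiff (Yup F y′ t) X * ι t) * KN F (Ylow F y′ t) E)
      ≈⟨ *-congˡ (KN-interpolation y′ X ι ι-inverse E) ⟩
    KN F (Ylow F y u) D * KN F X E
      ≈⟨ KN-++ (Ylow F y u) X D E ⟨
    KN F (Ylow F y u ++ X) (D ++ E) ∎
    where
    y′ : List⁺ Bool → Carrier
    y′ = shift y u
    α : Carrier
    α = prodDiff (Yup F y u) (Ylow F y u)
    B : Vec Bool e → Carrier
    B t = ⟨_,_⟩ F (Q F y (u ++ t)) (P F y (u ++ t))
    coefficient : Vec Bool e → Carrier
    coefficient t = ⟨_,_⟩ F (LN F (Yup F y (u ++ t))) (KN F (Ylow F y u ++ X)) * inv (B t) (nz t)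
    B-factor : ∀ t → B t ≈ α * prodDiff (Yup F y′ t) (Ylow F y′ t)
    B-factor t = begin
      B t ≡⟨ ≡.cong (λ W → ⟨_,_⟩ F (Q F y (u ++ t)) (KN F W)) (Ylow-++ y u t) ⟩
      ⟨_,_⟩ F (Q F y (u ++ t)) (KN F (Ylow F y u ++ Ylow F y′ t)) ≈⟨ pairing-Yup-++ y u t (Ylow F y′ t) ⟩
      α * prodDiff (Yup F y′ t) (Ylow F y′ t) ∎
    -- The common factor α of numerator and denominator cancels.
    ι : Vec Bool e → Carrier
    ι t = α * inv (B t) (nz t)
    ι-inverse : ∀ t → prodDiff (Yup F y′ t) (Ylow F y′ t) * ι t ≈ 1#
    ι-inverse t = begin
      prodDiff (Yup F y′ t) (Ylow F y′ t) * (α * inv (B t) (nz t))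
        ≈⟨ solve 3 (λ β α i → β :* (α :* i) := (α :* β) :* i) refl _ α _ ⟩
      (α * prodDiff (Yup F y′ t) (Ylow F y′ t)) * inv (B t) (nz t)
        ≈⟨ *-congʳ (B-factor t) ⟨
      B t * inv (B t) (nz t)
        ≈⟨ inverseʳ (B t) (nz t) ⟩
      1# ∎
    term : ∀ t D E → coefficient t * KN F (Ylow F y (u ++ t)) (D ++ E)
      ≈ KN F (Ylow F y u) D * ((prodDiff (Yup F y′ t) X * ι t) * KN F (Ylow F y′ t) E)
    term t D E = begin
      coefficient t * KN F (Ylow F y (u ++ t)) (D ++ E)
        ≡⟨ ≡.cong (λ W → coefficient t * KN F W (D ++ E)) (Ylow-++ y u t) ⟩
      coefficient t * KN F (Ylow F y u ++ Ylow F y′ t) (D ++ E)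
        ≈⟨ *-cong (*-congʳ (pairing-Yup-++ y u t X)) (KN-++ (Ylow F y u) (Ylow F y′ t) D E) ⟩
      ((α * prodDiff (Yup F y′ t) X) * inv (B t) (nz t)) * (KN F (Ylow F y u) D * KN F (Ylow F y′ t) E)
        ≈⟨ solve 5 (λ α γ i k K → ((α :* γ) :* i) :* (k :* K) := k :* ((γ :* (α :* i)) :* K))
             refl α _ _ _ _ ⟩
      KN F (Ylow F y u) D * ((prodDiff (Yup F y′ t) X * ι t) * KN F (Ylow F y′ t) E) ∎

mainTheorem3 : ∀ {c ℓ} (F : Field c ℓ) (y : List⁺ Bool → Field.Carrier F)
    (a b : ℕ) (u : Vec Bool a) (v : Vec Bool b)
    (nz : (t : Vec Bool (suc b)) →
          ¬ (Field._≈_ F (⟨_,_⟩ F (Q F y (u ++ t)) (P F y (u ++ t))) (Field.0# F))) →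
    _≋_ F (_⋆_ F (P F y u) (P F y v))
      (ΣS F (suc b) (λ t →
        _·_ F
          (Field._*_ F
            (⟨_,_⟩ F (LN F (Yup F y (u ++ t)))
                     (KN F (Ylow F y u ++ (Field.1# F ∷ Ylow F y v))))
            (Field.inv F (⟨_,_⟩ F (Q F y (u ++ t)) (P F y (u ++ t))) (nz t)))
          (P F y (u ++ t))))
mainTheorem3 F y a b u v nz D = begin
  _⋆_ F (P F y u) (P F y v) D          ≈⟨ KN-⋆ F (Ylow F y u) (Ylow F y v) D ⟩
  KN F (Ylow F y u ++ 1# ∷ Ylow F y v) D ≈⟨ KN-expansion F y u (1# ∷ Ylow F y v) nz D ⟨
  ΣS F (suc b) (λ t → _·_ F (⟨_,_⟩ F (LN F (Yup F y (u ++ t))) (KN F (Ylow F y u ++ 1# ∷ Ylow F y v))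
                               * inv (⟨_,_⟩ F (Q F y (u ++ t)) (P F y (u ++ t))) (nz t))
                            (P F y (u ++ t))) D ∎
  where
  open Field F
  open import Relation.Binary.Reasoning.Setoid setoid
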